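{- Heap isomorphism is a sound equivalence relation on singly linked heaps over $P$. That is, for all singly linked heaps $H, H'$ over $P$ with $H \simeq H'$, all pointer variables $x, y \in P$ and every transformer $\tau$ (any of $\mathit{new}(\cdot,x)$, $\mathit{assign}(\cdot,x,y)$, $\mathit{lookup}(\cdot,x,y)$, $\mathit{update}(\cdot,x,y)$ for any choice of pointer arguments): $\mathit{pathLength}(H,x,y)=\mathit{pathLength}(H',x,y)$, $\mathit{circular}(H,x)=\mathit{circular}(H',x)$, and $\tau(H)\simeq\tau(H')$.
   Context: Fix a finite set $P$ of pointer variables containing a distinguished variable $\mathbf{null}$. A heap over $P$ is a pair $H=\langle L,G\rangle$ where $G$ is a finite directed graph with vertex set $V(G)$ and edge set $E(G)$, and $L:P\to V(G)$ is a labelling function. $H$ is a singly linked heap iff every vertex $v$ either has outdegree $1$ and $v\neq L(\mathbf{null})$, or has outdegree $0$ and $v=L(\mathbf{null})$. For $v\neq L(\mathbf{null})$, $\mathrm{succ}(v)$ denotes the unique vertex with $(v,\mathrm{succ}(v))\in E(G)$. Write $u\xrightarrow{n}v$ if $v$ is reached from $u$ by following exactly $n$ edges ($u\xrightarrow{0}u$). Observations: $\mathit{pathLength}(H,x,y)=\min(\{n\mid L(x)\xrightarrow{n}L(y)\}\cup\{\infty\})$; $\mathit{circular}(H,x)$ holds iff there is a vertex $v$ with $L(x)\xrightarrow{n}v$ and $v\xrightarrow{m}L(x)$ for some $n,m>0$. Transformers (each changes only the listed components): $\mathit{new}(H,x)$ adds a fresh vertex $q$, adds the edge $(q,L(\mathbf{null}))$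 and sets $L[x\mapsto q]$; $\mathit{assign}(H,x,y)$ sets $L[x\mapsto L(y)]$; $\mathit{lookup}(H,x,y)$ sets $L[x\mapsto \mathrm{succ}(L(y))]$; $\mathit{update}(H,x,y)$ replaces the edge $(L(x),\mathrm{succ}(L(x)))$ by $(L(x),L(y))$ (lookup and update are applied only where the needed successor exists). The reachable sub-heap $H|_P$ is $H$ restricted to vertices reachable (by $\ge 0$ edges) from some $L(p)$, $p\in P$. Two heaps $H=\langle L,G\rangle$, $H'=\langle L',G'\rangle$ are isomorphic, $H\simeq H'$, iff there is a graph isomorphism $f:G|_P\to G'|_P$ between the reachable sub-heaps with $f(L(p))=L'(p)$ for all $p\in P$. -}

module Defs where

open import Data.Nat using (ℕ; zero; suc; _<_)
open import Data.Fin using (Fin; zero; suc; _≟_)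
open import Data.Bool using (Bool; true; false; if_then_else_; _∧_; _∨_; not)
open import Data.List using (List; length; filterᵇ; allFin)
open import Data.Maybe using (Maybe; just; nothing)
open import Data.Product using (Σ; ∃; ∃-syntax; _×_; _,_)
open import Data.Sum using (_⊎_)
open import Relation.Nullary using (¬_)
open import Relation.Nullary.Decidable using (⌊_⌋)
open import Relation.Binary.PropositionalEquality using (_≡_; _≢_)

-- Pointer variables: P = Fin k (a finite set); the distinguished variable
-- null : Fin k is passed explicitly where needed.

record Heap (k : ℕ) : Set where
  constructor heap
  field
    size : ℕ
    edge : Fin size → Fin size → Bool
    label : Fin k → Fin size
open Heap public

_==_ : ∀ {m} → Fin m → Fin m → Bool
a == b = ⌊ a ≟ b ⌋

relabel : ∀ {k} {A : Set} → (Fin k → A) → Fin k → A → Fin k → A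
relabel L x q p = if p == x then q else L p

outdeg : ∀ {k} (H : Heap k) → Fin (size H) → ℕ
outdeg H v = length (filterᵇ (edge H v) (allFin (size H)))

SinglyLinked : ∀ {k} → Fin k → Heap k → Set
SinglyLinked null H =
  ∀ v → (outdeg H v ≡ 1 × v ≢ label H null) ⊎ (outdeg H v ≡ 0 × v ≡ label H null)

data Steps {k} (H : Heap k) : Fin (size H) → ℕ → Fin (size H) → Set where
  here : ∀ {u} → Steps H u 0 u
  step : ∀ {u w n v} → edge H u w ≡ true → Steps H w n v → Steps H u (suc n) v

-- pathLength(H,x,y) = min ({n | L x →ⁿ L y} ∪ {∞}); ∞ is represented by
-- nothing.  IsPathLength H x y r  says that r is this minimum.
IsPathLength : ∀ {k} → Heap k → Fin k → Fin k → Maybe ℕ → Set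
IsPathLength H x y (just n) =
  Steps H (label H x) n (label H y) × (∀ m → m < n → ¬ Steps H (label H x) m (label H y))
IsPathLength H x y nothing = ∀ n → ¬ Steps H (label H x) n (label H y)

Circular : ∀ {k} → Heap k → Fin k → Set
Circular H x = ∃[ v ] ∃[ n ] ∃[ m ]
  (0 < n × 0 < m × Steps H (label H x) n v × Steps H v m (label H x))

Succ : ∀ {k} (H : Heap k) → Fin (size H) → Set
Succ H v = Σ (Fin (size H)) λ w → edge H v w ≡ true

-- transformers
-- the fresh vertex q is zero; the old vertices are embedded by suc
new : ∀ {k} → Fin k → Heap k → Fin k → Heap k
new null H x = heap (suc (size H)) E′ (relabel (λ p → suc (label H p)) x zero)
  where
  E′ : Fin (suc (size H)) → Fin (suc (size H)) → Bool
  E′ zero v = v == suc (label H null)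
  E′ (suc a) zero = false
  E′ (suc a) (suc b) = edge H a b

assign : ∀ {k} → Heap k → Fin k → Fin k → Heap k
assign H x y = heap (size H) (edge H) (relabel (label H) x (label H y))

lookup : ∀ {k} (H : Heap k) → Fin k → (y : Fin k) → Succ H (label H y) → Heap k
lookup H x y (w , _) = heap (size H) (edge H) (relabel (label H) x w)

-- update(H,x,y): replace the edge (L x , succ (L x)) by (L x , L y)
update : ∀ {k} (H : Heap k) → (x : Fin k) → Fin k → Succ H (label H x) → Heap k
update H x y (w , _) = heap (size H) E′ (label H)
  where
  E′ : Fin (size H) → Fin (size H) → Bool
  E′ u v = (edge H u v ∧ not (u == label H x ∧ v == w)) ∨ (u == label H x ∧ v == label H y)

Reachable : ∀ {k} (H : Heap k) → Fin (size H) → Set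
Reachable H v = ∃[ p ] ∃[ n ] Steps H (label H p) n v

-- H ≃ H' : a graph isomorphism f between the reachable sub-heaps
-- (given as a function on all vertices, only its restriction to reachable
-- vertices matters) respecting the labels.
record _≃_ {k} (H H′ : Heap k) : Set where
  field
    f : Fin (size H) → Fin (size H′)
    f-reach : ∀ v → Reachable H v → Reachable H′ (f v)
    f-inj : ∀ u v → Reachable H u → Reachable H v → f u ≡ f v → u ≡ v
    f-surj : ∀ v′ → Reachable H′ v′ → ∃[ v ] (Reachable H v × f v ≡ v′)
    f-edge : ∀ u v → Reachable H u → Reachable H v → edge H u v ≡ edge H′ (f u) (f v)
    f-label : ∀ p → f (label H p) ≡ label H′ p

module Submission where

-- The relation  H ≃ H′  of Defs only asks for a map f that is bijective on
-- the reachable sub-heaps.  We work instead with a two-sided notion, Iso,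
-- which carries an explicit inverse: a pair of maps to / from, each an
-- Embedding (label- and edge-preserving on reachable vertices, with the other
-- map as left inverse there).  Everything is proved for Iso, and the theorem
-- transfers the results along  Iso ⇒ ≃  and  ≃ ⇒ Iso.  The second direction
-- needs a total inverse function, which we obtain because reachability is
-- decidable: by the pigeonhole principle every path can be shortened to one
-- of length < |V|, and paths of bounded length can be searched exhaustively.
--
-- For the transformers the
-- only use of the singly linked hypothesis is that successors are unique;
-- assign, lookup and update keep the vertex set and are handled uniformly by
-- one lemma (rebuild), while new adds a vertex and is treated separately.

open import Defs
open import Data.Nat using (ℕ; zero; suc; _+_; _∸_; _<_; _≤_; z≤n; s≤s; _<?_)
open import Data.Nat.Properties using (≤-pred; ≮⇒≥; m≤n⇒m≤1+n; m+[n∸m]≡n; +-monoˡ-<)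
open import Data.Nat.Induction using (<-wellFounded)
open import Induction.WellFounded using (Acc; acc)
open import Data.Fin using (Fin; zero; suc; toℕ; fromℕ<; _≟_)
open import Data.Fin.Properties using (pigeonhole; any?; toℕ<n; toℕ-fromℕ<; suc-injective)
open import Data.Bool using (Bool; true; false; T; if_then_else_; _∧_; _∨_; not)
open import Data.Bool.Properties using () renaming (_≟_ to _≟ᵇ_)
open import Data.List using (_∷_; length; filterᵇ)
open import Data.List.Membership.Propositional using (_∈_)
open import Data.List.Relation.Unary.Any using (here; there)
open import Data.List.Membership.Propositional.Properties using (∈-allFin)
open import Data.Maybe using (Maybe; just; nothing)
open import Data.Product using (∃-syntax; _×_; _,_; proj₁; proj₂)
open import Data.Sum using (_⊎_; inj₁; inj₂)
open import Data.Empty using (⊥-elim)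
open import Data.Unit using (⊤; tt)
open import Relation.Nullary using (¬_; Dec; yes; no)
open import Relation.Nullary.Decidable using (⌊_⌋; _×-dec_; toWitness)
open import Relation.Binary.PropositionalEquality
open import Function.Bundles using (_⇔_; mk⇔)

does-cong : ∀ {P Q : Set} (P? : Dec P) (Q? : Dec Q) → (P → Q) → (Q → P) → ⌊ P? ⌋ ≡ ⌊ Q? ⌋
does-cong (yes p) (yes q) _ _ = refl
does-cong (yes p) (no ¬q) to _ = ⊥-elim (¬q (to p))
does-cong (no ¬p) (yes q) _ from = ⊥-elim (¬p (from q))
does-cong (no _) (no _) _ _ = refl

==-sound : ∀ {m} {a b : Fin m} → (a == b) ≡ true → a ≡ b
==-sound e = toWitness (subst T (sym e) tt)

module Paths {k} (H : Heap k) where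

  _++ₛ_ : ∀ {u a w b v} → Steps H u a w → Steps H w b v → Steps H u (a + b) v
  here ++ₛ t = t
  step e s ++ₛ t = step e (s ++ₛ t)

  label-reachable : ∀ p → Reachable H (label H p)
  label-reachable p = p , 0 , here

  reach-step : ∀ {u w} → Reachable H u → edge H u w ≡ true → Reachable H w
  reach-step (p , n , s) e = p , n + 1 , s ++ₛ step e here

  reachable-ind : (Q : Fin (size H) → Set) → (∀ p → Q (label H p)) →
    (∀ u w → Q u → edge H u w ≡ true → Q w) → ∀ v → Reachable H v → Q v
  reachable-ind Q q-label q-edge v (p , n , s) = go (q-label p) s
    where
    go : ∀ {u n v} → Q u → Steps H u n v → Q v
    go q here = q
    go q (step e s) = go (q-edge _ _ q e) s

  vertexAt : ∀ {u n v} → Steps H u n v → Fin (suc n) → Fin (size H)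
  vertexAt {u} s zero = u
  vertexAt (step e s) (suc i) = vertexAt s i

  prefix : ∀ {u n v} (s : Steps H u n v) (i : Fin (suc n)) → Steps H u (toℕ i) (vertexAt s i)
  prefix s zero = here
  prefix (step e s) (suc i) = step e (prefix s i)

  suffix : ∀ {u n v} (s : Steps H u n v) (i : Fin (suc n)) → Steps H (vertexAt s i) (n ∸ toℕ i) v
  suffix s zero = s
  suffix (step e s) (suc i) = suffix s i

  -- A path visiting more than |V| vertices repeats one (pigeonhole), and
  -- cutting out the cycle between the repetitions gives a shorter path.
  shorten : ∀ {u n v} → size H ≤ n → Steps H u n v → ∃[ m ] (m < n × Steps H u m v)
  shorten {u} {n} {v} |V|≤n s with pigeonhole (s≤s |V|≤n) (vertexAt s)
  ... | i , j , i<j , same =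
      toℕ i + (n ∸ toℕ j) , shorter ,
      prefix s i ++ₛ subst (λ z → Steps H z (n ∸ toℕ j) v) (sym same) (suffix s j)
    where
    shorter : toℕ i + (n ∸ toℕ j) < n
    shorter = subst (toℕ i + (n ∸ toℕ j) <_) (m+[n∸m]≡n (≤-pred (toℕ<n j)))
      (+-monoˡ-< (n ∸ toℕ j) i<j)

  short-path : ∀ {u n v} → Steps H u n v → ∃[ i ] Steps H u (toℕ {size H} i) v
  short-path s = go s (<-wellFounded _)
    where
    go : ∀ {u n v} → Steps H u n v → Acc _<_ n → ∃[ i ] Steps H u (toℕ {size H} i) v
    go {u} {n} {v} s (acc shorter-ok) with n <? size H
    ... | yes n<|V| = fromℕ< n<|V| , subst (λ m → Steps H u m v) (sym (toℕ-fromℕ< n<|V|)) s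
    ... | no n≮|V| with shorten (≮⇒≥ n≮|V|) s
    ...   | m , m<n , s′ = go s′ (shorter-ok m<n)

  steps? : ∀ n u v → Dec (Steps H u n v)
  steps? zero u v with u ≟ v
  ... | yes refl = yes here
  ... | no u≢v = no λ { here → u≢v refl }
  steps? (suc n) u v with any? (λ w → (edge H u w ≟ᵇ true) ×-dec steps? n w v)
  ... | yes (w , e , s) = yes (step e s)
  ... | no ¬path = no λ { (step {w = w} e s) → ¬path (w , e , s) }

  -- Reachability is decidable: search all variables and all lengths < |V|.
  reachable? : ∀ v → Dec (Reachable H v)
  reachable? v with any? (λ p → any? (λ (i : Fin (size H)) → steps? (toℕ i) (label H p) v))
  ... | yes (p , i , s) = yes (p , toℕ i , s)
  ... | no ¬found = no λ { (p , n , s) → ¬found (p , short-path s) }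

open Paths

record Embedding {k} (A B : Heap k) (to : Fin (size A) → Fin (size B))
  (from : Fin (size B) → Fin (size A)) : Set where
  field
    to-label : ∀ p → to (label A p) ≡ label B p
    from∘to : ∀ u → Reachable A u → from (to u) ≡ u
    to-edge : ∀ u v → Reachable A u → Reachable A v → edge A u v ≡ edge B (to u) (to v)

record Iso {k} (A B : Heap k) : Set where
  field
    to : Fin (size A) → Fin (size B)
    from : Fin (size B) → Fin (size A)
    to-embedding : Embedding A B to from
    from-embedding : Embedding B A from to
open Iso

module _ {k} {A B : Heap k} {to : Fin (size A) → Fin (size B)} {from : Fin (size B) → Fin (size A)}
  (emb : Embedding A B to from) where
  open Embedding emb

  map-steps : ∀ {u n v} → Reachable A u → Steps A u n v → Steps B (to u) n (to v)
  map-steps r here = here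
  map-steps r (step e s) = step (trans (sym (to-edge _ _ r r′)) e) (map-steps r′ s)
    where r′ = reach-step A r e

  map-reachable : ∀ v → Reachable A v → Reachable B (to v)
  map-reachable v (p , n , s) =
    p , n , subst (λ z → Steps B z n (to v)) (to-label p) (map-steps (label-reachable A p) s)

  map-label-steps : ∀ {x y n} → Steps A (label A x) n (label A y) → Steps B (label B x) n (label B y)
  map-label-steps {x} {y} {n} s =
    subst₂ (λ a b → Steps B a n b) (to-label x) (to-label y) (map-steps (label-reachable A x) s)

  -- An embedding does not identify reachable vertices, so it preserves
  -- the equality tests occurring in the transformers.
  to-injective : ∀ u v → Reachable A u → Reachable A v → to u ≡ to v → u ≡ v
  to-injective u v ru rv eq = trans (sym (from∘to u ru)) (trans (cong from eq) (from∘to v rv))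

  to-== : ∀ u v → Reachable A u → Reachable A v → (u == v) ≡ (to u == to v)
  to-== u v ru rv = does-cong (u ≟ v) (to u ≟ to v) (cong to) (to-injective u v ru rv)

  to-==-label : ∀ u x → Reachable A u → (u == label A x) ≡ (to u == label B x)
  to-==-label u x ru = trans (to-== u (label A x) ru (label-reachable A x)) (cong (to u ==_) (to-label x))

Iso-sym : ∀ {k} {A B : Heap k} → Iso A B → Iso B A
Iso-sym D = record { to = from D ; from = to D ; to-embedding = from-embedding D ; from-embedding = to-embedding D }

Iso-refl : ∀ {k} (A : Heap k) → Iso A A
Iso-refl A = record { to = λ v → v ; from = λ v → v ; to-embedding = identity ; from-embedding = identity }
  where
  identity : Embedding A A (λ v → v) (λ v → v)
  identity = record { to-label = λ _ → refl ; from∘to = λ _ _ → refl ; to-edge = λ _ _ _ _ → refl }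

embedding-∘ : ∀ {k} {A B C : Heap k} {f : Fin (size A) → Fin (size B)} {f⁻ : Fin (size B) → Fin (size A)}
  {g : Fin (size B) → Fin (size C)} {g⁻ : Fin (size C) → Fin (size B)} →
  Embedding A B f f⁻ → Embedding B C g g⁻ → Embedding A C (λ v → g (f v)) (λ v → f⁻ (g⁻ v))
embedding-∘ {f = f} {f⁻} {g} {g⁻} F G = record
  { to-label = λ p → trans (cong g (F.to-label p)) (G.to-label p)
  ; from∘to = λ u r → trans (cong f⁻ (G.from∘to (f u) (map-reachable F u r))) (F.from∘to u r)
  ; to-edge = λ u v ru rv →
      trans (F.to-edge u v ru rv) (G.to-edge _ _ (map-reachable F u ru) (map-reachable F v rv))
  }
  where
  module F = Embedding F
  module G = Embedding G

Iso-trans : ∀ {k} {A B C : Heap k} → Iso A B → Iso B C → Iso A C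
Iso-trans D E = record
  { to = λ v → to E (to D v)
  ; from = λ v → from D (from E v)
  ; to-embedding = embedding-∘ (to-embedding D) (to-embedding E)
  ; from-embedding = embedding-∘ (from-embedding E) (from-embedding D)
  }

Iso⇒≃ : ∀ {k} {A B : Heap k} → Iso A B → A ≃ B
Iso⇒≃ D = record
  { f = to D
  ; f-reach = map-reachable (to-embedding D)
  ; f-inj = to-injective (to-embedding D)
  ; f-surj = λ v′ r →
      from D v′ , map-reachable (from-embedding D) v′ r , Embedding.from∘to (from-embedding D) v′ r
  ; f-edge = Embedding.to-edge (to-embedding D)
  ; f-label = Embedding.to-label (to-embedding D)
  }

-- Conversely an isomorphism yields an Iso: the inverse sends a reachable
-- vertex of B to its preimage, and anything else to a default vertex d.
module _ {k} {A B : Heap k} (d : Fin (size A)) (I : A ≃ B) where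
  open _≃_ I

  preimage : ∀ v′ → Dec (Reachable B v′) → Fin (size A)
  preimage v′ (yes r) = proj₁ (f-surj v′ r)
  preimage v′ (no _) = d

  inverse : Fin (size B) → Fin (size A)
  inverse v′ = preimage v′ (reachable? B v′)

  inverse-spec : ∀ v′ → Reachable B v′ → Reachable A (inverse v′) × f (inverse v′) ≡ v′
  inverse-spec v′ r with reachable? B v′
  ... | yes r′ = proj₂ (f-surj v′ r′)
  ... | no ¬r = ⊥-elim (¬r r)

  inverse∘f : ∀ u → Reachable A u → inverse (f u) ≡ u
  inverse∘f u r = f-inj _ _ (proj₁ (inverse-spec (f u) f-r)) r (proj₂ (inverse-spec (f u) f-r))
    where f-r = f-reach u r

  ≃⇒Iso : Iso A B
  ≃⇒Iso = record
    { to = f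
    ; from = inverse
    ; to-embedding = record { to-label = f-label ; from∘to = inverse∘f ; to-edge = f-edge }
    ; from-embedding = record
      { to-label = λ p → trans (cong inverse (sym (f-label p))) (inverse∘f _ (label-reachable A p))
      ; from∘to = λ v′ r → proj₂ (inverse-spec v′ r)
      ; to-edge = inverse-edge
      }
    }
    where
    inverse-edge : ∀ u′ v′ → Reachable B u′ → Reachable B v′ →
      edge B u′ v′ ≡ edge A (inverse u′) (inverse v′)
    inverse-edge u′ v′ ru′ rv′ = begin
      edge B u′ v′
        ≡⟨ sym (cong₂ (edge B) (proj₂ (inverse-spec u′ ru′)) (proj₂ (inverse-spec v′ rv′))) ⟩
      edge B (f (inverse u′)) (f (inverse v′))
        ≡⟨ sym (f-edge _ _ (proj₁ (inverse-spec u′ ru′)) (proj₁ (inverse-spec v′ rv′))) ⟩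
      edge A (inverse u′) (inverse v′) ∎
      where open ≡-Reasoning

-- Paths between labelled vertices correspond in both directions, so the
-- minimum path length is the same.
pathLength-transport : ∀ {k} {A B : Heap k} (D : Iso A B) x y r → IsPathLength A x y r → IsPathLength B x y r
pathLength-transport D x y (just n) (s , minimal) =
  map-label-steps (to-embedding D) s , λ m m<n s′ → minimal m m<n (map-label-steps (from-embedding D) s′)
pathLength-transport D x y nothing none = λ n s′ → none n (map-label-steps (from-embedding D) s′)

circular-transport : ∀ {k} {A B : Heap k} (D : Iso A B) x → Circular A x → Circular B x
circular-transport {A = A} {B} D x (v , n , m , 0<n , 0<m , out , back) =
  to D v , n , m , 0<n , 0<m
  , subst (λ z → Steps B z n (to D v)) (to-label x) (map-steps emb (label-reachable A x) out)
  , subst (λ z → Steps B (to D v) m z) (to-label x) (map-steps emb (x , n , out) back)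
  where
  emb = to-embedding D
  open Embedding emb

filter-length-≥1 : ∀ {A : Set} (P : A → Bool) {a : A} {xs} → a ∈ xs → P a ≡ true →
  1 ≤ length (filterᵇ P xs)
filter-length-≥1 P {xs = x ∷ xs} (here refl) Pa with P x
... | true = s≤s z≤n
filter-length-≥1 P {xs = x ∷ xs} (there a∈) Pa with P x
... | true = s≤s z≤n
... | false = filter-length-≥1 P a∈ Pa

filter-length-≥2 : ∀ {A : Set} (P : A → Bool) {a b : A} {xs} → a ∈ xs → b ∈ xs → a ≢ b →
  P a ≡ true → P b ≡ true → 2 ≤ length (filterᵇ P xs)
filter-length-≥2 P (here refl) (here refl) a≢b _ _ = ⊥-elim (a≢b refl)
filter-length-≥2 P {xs = x ∷ xs} (here refl) (there b∈) a≢b Pa Pb with P x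
... | true = s≤s (filter-length-≥1 P b∈ Pb)
filter-length-≥2 P {xs = x ∷ xs} (there a∈) (here refl) a≢b Pa Pb with P x
... | true = s≤s (filter-length-≥1 P a∈ Pa)
filter-length-≥2 P {xs = x ∷ xs} (there a∈) (there b∈) a≢b Pa Pb with P x
... | true = m≤n⇒m≤1+n (filter-length-≥2 P a∈ b∈ a≢b Pa Pb)
... | false = filter-length-≥2 P a∈ b∈ a≢b Pa Pb

-- Two out-edges of one vertex would give outdegree ≥ 2.
successor-unique : ∀ {k} (null : Fin k) (H : Heap k) → SinglyLinked null H →
  ∀ {u a b} → edge H u a ≡ true → edge H u b ≡ true → a ≡ b
successor-unique null H linked {u} {a} {b} ea eb with a ≟ b
... | yes a≡b = a≡b
... | no a≢b with filter-length-≥2 (edge H u) (∈-allFin a) (∈-allFin b) a≢b ea eb | linked u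
...   | two≤ | inj₁ (deg≡1 , _) = ⊥-elim (two≰one (subst (2 ≤_) deg≡1 two≤))
  where
  two≰one : ¬ (2 ≤ 1)
  two≰one (s≤s ())
...   | two≤ | inj₂ (deg≡0 , _) = ⊥-elim (two≰zero (subst (2 ≤_) deg≡0 two≤))
  where
  two≰zero : ¬ (2 ≤ 0)
  two≰zero ()

successor-transport : ∀ {k} (null : Fin k) {H H′ : Heap k} (D : Iso H H′) → SinglyLinked null H′ →
  ∀ y {w w′} → edge H (label H y) w ≡ true → edge H′ (label H′ y) w′ ≡ true → to D w ≡ w′
successor-transport null {H} {H′} D linked′ y {w} e e′ = successor-unique null H′ linked′ e-image e′
  where
  open Embedding (to-embedding D)
  e-image : edge H′ (label H′ y) (to D w) ≡ true
  e-image = subst (λ z → edge H′ z (to D w) ≡ true) (to-label y)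
    (trans (sym (to-edge _ _ (label-reachable H y) (reach-step H (label-reachable H y) e))) e)

reachable-within : ∀ {k} (H : Heap k) (E : Fin (size H) → Fin (size H) → Bool) (L : Fin k → Fin (size H)) →
  (∀ p → Reachable H (L p)) → (∀ u v → Reachable H u → E u v ≡ true → Reachable H v) →
  ∀ v → Reachable (heap (size H) E L) v → Reachable H v
reachable-within H E L labels-in edges-in = reachable-ind (heap (size H) E L) (Reachable H) labels-in edges-in

rebuild : ∀ {k} {H H′ : Heap k} (D : Iso H H′)
  (E : Fin (size H) → Fin (size H) → Bool) (L : Fin k → Fin (size H))
  (E′ : Fin (size H′) → Fin (size H′) → Bool) (L′ : Fin k → Fin (size H′)) →
  (∀ v → Reachable (heap (size H) E L) v → Reachable H v) →
  (∀ v → Reachable (heap (size H′) E′ L′) v → Reachable H′ v) →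
  (∀ p → to D (L p) ≡ L′ p) →
  (∀ u v → Reachable H u → Reachable H v → E u v ≡ E′ (to D u) (to D v)) →
  Iso (heap (size H) E L) (heap (size H′) E′ L′)
rebuild D E L E′ L′ within within′ to-L to-E = record
  { to = to D
  ; from = from D
  ; to-embedding = record
    { to-label = to-L
    ; from∘to = λ u r → F.from∘to u (within u r)
    ; to-edge = λ u v ru rv → to-E u v (within u ru) (within v rv)
    }
  ; from-embedding = record
    { to-label = λ p → trans (cong (from D) (sym (to-L p))) (F.from∘to _ (within _ (label-reachable _ p)))
    ; from∘to = λ u′ r → G.from∘to u′ (within′ u′ r)
    ; to-edge = λ u′ v′ ru′ rv′ → sym (trans (to-E _ _ (back u′ ru′) (back v′ rv′))
        (cong₂ E′ (G.from∘to u′ (within′ u′ ru′)) (G.from∘to v′ (within′ v′ rv′))))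
    }
  }
  where
  module F = Embedding (to-embedding D)
  module G = Embedding (from-embedding D)
  back : ∀ v′ → Reachable (heap _ E′ L′) v′ → Reachable _ (from D v′)
  back v′ r = map-reachable (from-embedding D) v′ (within′ v′ r)

relabel-reachable : ∀ {k} (H : Heap k) x q → Reachable H q → ∀ v →
  Reachable (heap (size H) (edge H) (relabel (label H) x q)) v → Reachable H v
relabel-reachable H x q rq = reachable-within H (edge H) (relabel (label H) x q)
  (λ p → relabel-case (p == x))
  (λ u v r e → reach-step H r e)
  where
  relabel-case : ∀ {p} b → Reachable H (if b then q else label H p)
  relabel-case true = rq
  relabel-case {p} false = label-reachable H p

relabel-map : ∀ {k} {A B : Set} (f : A → B) (L : Fin k → A) (L′ : Fin k → B) x q q′ →
  f q ≡ q′ → (∀ p → f (L p) ≡ L′ p) → ∀ p → f (relabel L x q p) ≡ relabel L′ x q′ p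
relabel-map f L L′ x q q′ fq fL p = relabel-case (p == x)
  where
  relabel-case : ∀ b → f (if b then q else L p) ≡ (if b then q′ else L′ p)
  relabel-case true = fq
  relabel-case false = fL p

relabel-iso : ∀ {k} {H H′ : Heap k} (D : Iso H H′) x q q′ → Reachable H q → Reachable H′ q′ →
  to D q ≡ q′ →
  Iso (heap (size H) (edge H) (relabel (label H) x q)) (heap (size H′) (edge H′) (relabel (label H′) x q′))
relabel-iso {H = H} {H′} D x q q′ rq rq′ to-q =
  rebuild D (edge H) (relabel (label H) x q) (edge H′) (relabel (label H′) x q′)
    (relabel-reachable H x q rq) (relabel-reachable H′ x q′ rq′)
    (relabel-map (to D) (label H) (label H′) x q q′ to-q to-label) to-edge
  where open Embedding (to-embedding D)

-- An edge of update(H,x,y) is an old edge or ends at L y.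
update-edge-cases : ∀ a b c d → ((a ∧ not (b ∧ c)) ∨ (b ∧ d)) ≡ true → a ≡ true ⊎ d ≡ true
update-edge-cases true b c d _ = inj₁ refl
update-edge-cases false true c true _ = inj₂ refl
update-edge-cases false true c false ()
update-edge-cases false false c d ()

update-iso : ∀ {k} (null : Fin k) {H H′ : Heap k} (D : Iso H H′) → SinglyLinked null H′ →
  ∀ x y (s : Succ H (label H x)) (s′ : Succ H′ (label H′ x)) → Iso (update H x y s) (update H′ x y s′)
update-iso null {H} {H′} D linked′ x y (w , e) (w′ , e′) =
  rebuild D (edge (update H x y (w , e))) (label H) (edge (update H′ x y (w′ , e′))) (label H′)
    (within H x y (w , e)) (within H′ x y (w′ , e′)) to-label
    λ u v ru rv → cong₂ _∨_
      (cong₂ _∧_ (to-edge u v ru rv)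
        (cong not (cong₂ _∧_ (to-==-label emb u x ru) (trans (to-== emb v w rv rw) (cong (to D v ==_) to-w)))))
      (cong₂ _∧_ (to-==-label emb u x ru) (to-==-label emb v y rv))
  where
  emb = to-embedding D
  open Embedding emb
  rw = reach-step H (label-reachable H x) e
  to-w = successor-transport null D linked′ x e e′
  within : ∀ (G : Heap _) x y (s : Succ G (label G x)) v → Reachable (update G x y s) v → Reachable G v
  within G x y s@(w , _) = reachable-within G (edge (update G x y s)) (label G) (label-reachable G) edge-in
    where
    edge-in : ∀ u v → Reachable G u → edge (update G x y s) u v ≡ true → Reachable G v
    edge-in u v r e with update-edge-cases (edge G u v) (u == label G x) (v == w) (v == label G y) e
    ... | inj₁ old = reach-step G r old
    ... | inj₂ to-y = subst (Reachable G) (sym (==-sound to-y)) (label-reachable G y)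

ReachableInNew : ∀ {k} (H : Heap k) → Fin (suc (size H)) → Set
ReachableInNew H zero = ⊤
ReachableInNew H (suc a) = Reachable H a

new-reachable : ∀ {k} (null : Fin k) (H : Heap k) x v → Reachable (new null H x) v → ReachableInNew H v
new-reachable null H x = reachable-ind (new null H x) (ReachableInNew H) labels-in edges-in
  where
  labels-in : ∀ p → ReachableInNew H (relabel (λ p → suc (label H p)) x zero p)
  labels-in p with p == x
  ... | true = tt
  ... | false = label-reachable H p
  edges-in : ∀ u v → ReachableInNew H u → edge (new null H x) u v ≡ true → ReachableInNew H v
  edges-in _ zero _ _ = tt
  edges-in zero (suc b) _ e = subst (Reachable H) (sym (suc-injective (==-sound e))) (label-reachable H null)
  edges-in (suc a) (suc b) r e = reach-step H r e

liftFin : ∀ {m n} → (Fin m → Fin n) → Fin (suc m) → Fin (suc n)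
liftFin f zero = zero
liftFin f (suc a) = suc (f a)

new-embedding : ∀ {k} (null : Fin k) {H H′ : Heap k} (D : Iso H H′) x →
  Embedding (new null H x) (new null H′ x) (liftFin (to D)) (liftFin (from D))
new-embedding null {H} {H′} D x = record
  { to-label = relabel-map (liftFin (to D)) (λ p → suc (label H p)) (λ p → suc (label H′ p))
      x zero zero refl (λ p → cong suc (to-label p))
  ; from∘to = from∘to-new
  ; to-edge = to-edge-new
  }
  where
  emb = to-embedding D
  open Embedding emb
  from∘to-new : ∀ u → Reachable (new null H x) u → liftFin (from D) (liftFin (to D) u) ≡ u
  from∘to-new zero _ = refl
  from∘to-new (suc a) r = cong suc (from∘to a (new-reachable null H x (suc a) r))
  -- the fresh vertex points exactly to the image of L null
  to-edge-new : ∀ u v → Reachable (new null H x) u → Reachable (new null H x) v →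
    edge (new null H x) u v ≡ edge (new null H′ x) (liftFin (to D) u) (liftFin (to D) v)
  to-edge-new zero zero _ _ = refl
  to-edge-new zero (suc b) _ rv = does-cong (suc b ≟ suc (label H null)) (suc (to D b) ≟ suc (label H′ null))
    (λ eq → cong suc (trans (cong (to D) (suc-injective eq)) (to-label null)))
    (λ eq → cong suc (to-injective emb b (label H null) (new-reachable null H x (suc b) rv) (label-reachable H null)
      (trans (suc-injective eq) (sym (to-label null)))))
  to-edge-new (suc a) zero _ _ = refl
  to-edge-new (suc a) (suc b) ru rv = to-edge a b (new-reachable null H x (suc a) ru) (new-reachable null H x (suc b) rv)

new-iso : ∀ {k} (null : Fin k) {H H′ : Heap k} (D : Iso H H′) x → Iso (new null H x) (new null H′ x)
new-iso null D x = record
  { to = liftFin (to D)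
  ; from = liftFin (from D)
  ; to-embedding = new-embedding null D x
  ; from-embedding = new-embedding null (Iso-sym D) x
  }

Iso-sound : ∀ {k} (null : Fin k) {H H′ : Heap k} → Iso H H′ → SinglyLinked null H′ → ∀ (x y : Fin k) →
  (∀ (r : Maybe ℕ) → IsPathLength H x y r ⇔ IsPathLength H′ x y r)
  × (Circular H x ⇔ Circular H′ x)
  × Iso (new null H x) (new null H′ x)
  × Iso (assign H x y) (assign H′ x y)
  × (∀ (s : Succ H (label H y)) (s′ : Succ H′ (label H′ y)) → Iso (lookup H x y s) (lookup H′ x y s′))
  × (∀ (s : Succ H (label H x)) (s′ : Succ H′ (label H′ x)) → Iso (update H x y s) (update H′ x y s′))
Iso-sound null {H} {H′} D linked′ x y =
  (λ r → mk⇔ (pathLength-transport D x y r) (pathLength-transport (Iso-sym D) x y r))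
  , mk⇔ (circular-transport D x) (circular-transport (Iso-sym D) x)
  , new-iso null D x
  , relabel-iso D x (label H y) (label H′ y) (label-reachable H y) (label-reachable H′ y) (to-label y)
  , (λ { (w , e) (w′ , e′) → relabel-iso D x w w′
      (reach-step H (label-reachable H y) e) (reach-step H′ (label-reachable H′ y) e′)
      (successor-transport null D linked′ y e e′) })
  , update-iso null D linked′ x y
  where open Embedding (to-embedding D)

-- The theorem: ≃ and Iso are interconvertible (a default vertex for the
-- inverse is L null), so both parts follow from the results on Iso.

theorem1 : ∀ {k} (null : Fin k) →
    (∀ (H : Heap k) → SinglyLinked null H → H ≃ H)
    × (∀ (H H′ : Heap k) → SinglyLinked null H → SinglyLinked null H′ → H ≃ H′ → H′ ≃ H)
    × (∀ (H H′ H″ : Heap k) → SinglyLinked null H → SinglyLinked null H′ → SinglyLinked null H″ →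
         H ≃ H′ → H′ ≃ H″ → H ≃ H″)
    × (∀ (H H′ : Heap k) → SinglyLinked null H → SinglyLinked null H′ → H ≃ H′ →
         ∀ (x y : Fin k) →
           (∀ (r : Maybe ℕ) → IsPathLength H x y r ⇔ IsPathLength H′ x y r)
           × (Circular H x ⇔ Circular H′ x)
           × (new null H x ≃ new null H′ x)
           × (assign H x y ≃ assign H′ x y)
           × (∀ (s : Succ H (label H y)) (s′ : Succ H′ (label H′ y)) →
                lookup H x y s ≃ lookup H′ x y s′)
           × (∀ (s : Succ H (label H x)) (s′ : Succ H′ (label H′ x)) →
                update H x y s ≃ update H′ x y s′))
theorem1 null =
  (λ H _ → Iso⇒≃ (Iso-refl H))
  , (λ H H′ _ _ I → Iso⇒≃ (Iso-sym (≃⇒Iso (label H null) I)))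
  , (λ H H′ H″ _ _ _ I J → Iso⇒≃ (Iso-trans (≃⇒Iso (label H null) I) (≃⇒Iso (label H′ null) J)))
  , λ H H′ _ linked′ I x y →
      let (path , circ , new≅ , assign≅ , lookup≅ , update≅) =
            Iso-sound null (≃⇒Iso (label H null) I) linked′ x y
      in path , circ , Iso⇒≃ new≅ , Iso⇒≃ assign≅
         , (λ s s′ → Iso⇒≃ (lookup≅ s s′)) , (λ s s′ → Iso⇒≃ (update≅ s s′))
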